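{- Let $k\ge 1$ and let $n,a$ be integers with $0\leq a<\partial^{k+1}(n)$. Let $n=\sum_{i=1}^{k+1}\binom{n_i}{i}$ be the $(k+1)$-binomial representation of $n$, $a=\sum_{i=1}^{k}\binom{a_i}{i}$ the $k$-binomial representation of $a$, and $b=n-a=\sum_{i=1}^{k+1}\binom{b_i}{i}$ the $(k+1)$-binomial representation of $b=n-a$. Then $a_k<n_{k+1}\leq b_{k+1}+1$.
   Context: Binomial coefficients follow the convention $\binom{m}{j}=0$ whenever $m<j$ (including negative $m$), and $\binom{m}{0}=1$ for $m\ge 0$. For integers $k\geq 1$ and $n\geq 0$ there is a unique way to write $n=\binom{n_k}{k}+\cdots+\binom{n_1}{1}$ with $0\leq n_1<n_2<\cdots<n_k$ (the $k$-binomial representation of $n$). The Kruskal–Macaulay function is $\partial^{k}(n)=\binom{n_k-1}{k-1}+\binom{n_{k-1}-1}{k-2}+\cdots+\binom{n_1-1}{0}$, computed from the $k$-binomial representation of $n$. -}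

module Defs where

open import Data.Nat using (ℕ; zero; suc; _+_; _<_)
open import Data.Nat.Combinatorics using (_C_)
open import Data.Vec using (Vec; []; _∷_; lookup)
open import Data.Fin using (Fin) renaming (_<_ to _<ᶠ_)
open import Data.Product using (_×_)

-- Binomial coefficient C(m - 1, j) for m : ℕ, with the convention
-- C(-1, j) = 0 for every j (including j = 0).
binomPred : ℕ → ℕ → ℕ
binomPred zero    j = 0
binomPred (suc m) j = m C j

-- A vector (x₁ , … , x_k) (position p holds x_{p+1}).
-- binSumFrom j v = Σ_p C(v_p , j + p + 1)
binSumFrom : ∀ {k} → ℕ → Vec ℕ k → ℕ
binSumFrom j []       = 0
binSumFrom j (x ∷ xs) = x C (suc j) + binSumFrom (suc j) xs

binSum : ∀ {k} → Vec ℕ k → ℕ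
binSum = binSumFrom 0

kmSumFrom : ∀ {k} → ℕ → Vec ℕ k → ℕ
kmSumFrom j []       = 0
kmSumFrom j (x ∷ xs) = binomPred x j + kmSumFrom (suc j) xs

kmSum : ∀ {k} → Vec ℕ k → ℕ
kmSum = kmSumFrom 0

StrictlyIncreasing : ∀ {k} → Vec ℕ k → Set
StrictlyIncreasing {k} v = (i j : Fin k) → i <ᶠ j → lookup v i < lookup v j

IsBinRep : (k : ℕ) → ℕ → Vec ℕ k → Set
IsBinRep k n v = StrictlyIncreasing v × binSum v ≡′ n
  where open import Relation.Binary.PropositionalEquality renaming (_≡_ to _≡′_)

-- Kruskal–Macaulay function ∂^k(n), computed from a k-binomial
-- representation v of n (which is unique).
∂ : ∀ {k} → Vec ℕ k → ℕ
∂ = kmSum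

module Submission where

-- Write k = m + 1, N = n_{k+1}.  Everything follows from three
-- estimates on sums of binomial coefficients along a strictly increasing
-- vector v = (v₁ < … < v_l):
--   (lower)  C(v_l , l) ≤ Σ C(v_i , i)                 (drop all but the top term),
--   (upper)  Σ C(v_i , i) < C(v_l + 1 , l)             (telescoping Pascal's rule),
--   (shadow) ∂(v) + C(v_l - 1 , l) ≤ Σ C(v_i , i)      (Pascal's rule termwise).
-- Moreover ∂ of a (k+1)-representation (x ∷ w) is at most 1 plus the
-- k-binomial sum of (w - 1), so (upper) gives ∂(n) ≤ C(N , k).  Then
--   C(a_k , k) ≤ a < ∂(n) ≤ C(N , k)                        gives a_k < N, and
--   C(N - 1 , k+1) < n - a = b < C(b_{k+1} + 1 , k+1)        gives N ≤ b_{k+1} + 1,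
-- since C(- , j) is monotone in its upper argument.

open import Defs
open import Data.Nat using (ℕ; suc; _+_; _∸_; _<_; _≤_)
open import Data.Vec using (Vec; last)
open import Data.Product using (_×_)

open import Data.Nat using (zero; pred; z≤n; s≤s; NonZero; >-nonZero; _≤′_; ≤′-refl; ≤′-step)
open import Data.Nat.Properties
open import Data.Nat.Combinatorics using (_C_; nCk+nC[k+1]≡[n+1]C[k+1]; k>n⇒nCk≡0)
open import Data.Vec using ([]; _∷_; map; head)
open import Data.Vec.Relation.Unary.Linked using (Linked; []; [-]; _∷_)
open import Data.Fin using () renaming (zero to fzero; suc to fsuc)
open import Data.Product using (_,_)
open import Relation.Binary.PropositionalEquality using (_≡_; refl; sym; cong; cong₂; subst)

C-step : ∀ n k → n C k ≤ suc n C k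
C-step n zero    = ≤-refl
C-step n (suc k) = begin
  n C suc k              ≤⟨ m≤n+m (n C suc k) (n C k) ⟩
  n C k + n C suc k      ≡⟨ nCk+nC[k+1]≡[n+1]C[k+1] n k ⟩
  suc n C suc k          ∎
  where open ≤-Reasoning

C-monoˡ-≤ : ∀ {m n} k → m ≤ n → m C k ≤ n C k
C-monoˡ-≤ k m≤n = go (≤⇒≤′ m≤n)
  where
  go : ∀ {m n} → m ≤′ n → m C k ≤ n C k
  go ≤′-refl        = ≤-refl
  go (≤′-step m≤′n) = ≤-trans (go m≤′n) (C-step _ k)

C-cancelˡ-< : ∀ {m n} k → m C k < n C k → m < n
C-cancelˡ-< k lt = ≰⇒> (λ n≤m → <⇒≱ lt (C-monoˡ-≤ k n≤m))

-- Strictly increasing vectors, in the inductive form "consecutive entries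
-- are increasing", which is what the recursive estimates below consume.

Increasing : ∀ {l} → Vec ℕ l → Set
Increasing = Linked _<_

strictlyIncreasing⇒increasing : ∀ {l} (v : Vec ℕ l) → StrictlyIncreasing v → Increasing v
strictlyIncreasing⇒increasing []           _   = []
strictlyIncreasing⇒increasing (x ∷ [])     _   = [-]
strictlyIncreasing⇒increasing (x ∷ y ∷ ys) inc =
  inc fzero (fsuc fzero) (s≤s z≤n)
    ∷ strictlyIncreasing⇒increasing (y ∷ ys) (λ i j i<j → inc (fsuc i) (fsuc j) (s≤s i<j))

head<last : ∀ {l} x (v : Vec ℕ (suc l)) → Increasing (x ∷ v) → x < last v
head<last x (y ∷ [])     (x<y ∷ _)   = x<y
head<last x (y ∷ z ∷ zs) (x<y ∷ inc) = <-trans x<y (head<last y (z ∷ zs) inc)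

last-nonZero : ∀ {l} x (v : Vec ℕ (suc l)) → Increasing (x ∷ v) → NonZero (last v)
last-nonZero x v inc = >-nonZero (m<n⇒0<n (head<last x v inc))

-- ∂ is computed through the decremented vector, whose top entry is N - 1.
last-map : ∀ {l} (f : ℕ → ℕ) (v : Vec ℕ (suc l)) → last (map f v) ≡ f (last v)
last-map f (x ∷ [])     = refl
last-map f (x ∷ y ∷ ys) = last-map f (y ∷ ys)

increasing-pred : ∀ {l} x (xs : Vec ℕ l) → Increasing (x ∷ xs) → Increasing (map pred xs)
increasing-pred x []                   _                     = []
increasing-pred x (y ∷ [])             _                     = [-]
increasing-pred x (suc y ∷ suc z ∷ zs) (x<y ∷ s≤s y<z ∷ inc) =
  y<z ∷ increasing-pred (suc y) (suc z ∷ zs) (s≤s y<z ∷ inc)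

binSumFrom-lower : ∀ {l} j (v : Vec ℕ (suc l)) → last v C suc (j + l) ≤ binSumFrom j v
binSumFrom-lower {zero} j (x ∷ []) rewrite +-identityʳ j = m≤m+n (x C suc j) 0
binSumFrom-lower {suc l} j (x ∷ y ∷ ys) = begin
  last (y ∷ ys) C suc (j + suc l)  ≡⟨ cong (λ t → last (y ∷ ys) C suc t) (+-suc j l) ⟩
  last (y ∷ ys) C suc (suc j + l)  ≤⟨ binSumFrom-lower (suc j) (y ∷ ys) ⟩
  binSumFrom (suc j) (y ∷ ys)      ≤⟨ m≤n+m _ (x C suc j) ⟩
  binSumFrom j (x ∷ y ∷ ys)        ∎
  where open ≤-Reasoning

-- (upper) Adding C(v₁ , j) makes the sum telescope by Pascal's rule; the
-- increasing hypothesis lets each partial result be bounded by the next term.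
binSumFrom-upper : ∀ {l} j (v : Vec ℕ (suc l)) → Increasing v →
                   head v C j + binSumFrom j v ≤ suc (last v) C suc (j + l)
binSumFrom-upper {zero} j (x ∷ []) _ = begin
  x C j + (x C suc j + 0)  ≡⟨ cong (x C j +_) (+-identityʳ (x C suc j)) ⟩
  x C j + x C suc j        ≡⟨ nCk+nC[k+1]≡[n+1]C[k+1] x j ⟩
  suc x C suc j            ≡⟨ cong (λ t → suc x C suc t) (sym (+-identityʳ j)) ⟩
  suc x C suc (j + 0)      ∎
  where open ≤-Reasoning
binSumFrom-upper {suc l} j (x ∷ y ∷ ys) (x<y ∷ inc) = begin
  x C j + (x C suc j + B)            ≡⟨ sym (+-assoc (x C j) (x C suc j) B) ⟩
  (x C j + x C suc j) + B            ≡⟨ cong (_+ B) (nCk+nC[k+1]≡[n+1]C[k+1] x j) ⟩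
  suc x C suc j + B                  ≤⟨ +-monoˡ-≤ B (C-monoˡ-≤ (suc j) x<y) ⟩
  y C suc j + B                      ≤⟨ binSumFrom-upper (suc j) (y ∷ ys) inc ⟩
  suc L C suc (suc j + l)            ≡⟨ cong (λ t → suc L C suc t) (sym (+-suc j l)) ⟩
  suc L C suc (j + suc l)            ∎
  where
  open ≤-Reasoning
  B = binSumFrom (suc j) (y ∷ ys)
  L = last (y ∷ ys)

binomPred-pascal : ∀ x j → binomPred x j + pred x C suc j ≡ x C suc j
binomPred-pascal zero    j = refl
binomPred-pascal (suc x) j = nCk+nC[k+1]≡[n+1]C[k+1] x j

-- (shadow) Each term C(v_i , i) splits into its shadow term C(v_i - 1 , i - 1)
-- and C(v_i - 1 , i); keep all shadow terms and the remainder of the top one.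
kmSumFrom-shadow : ∀ {l} j (v : Vec ℕ (suc l)) →
                   kmSumFrom j v + pred (last v) C suc (j + l) ≤ binSumFrom j v
kmSumFrom-shadow {zero} j (x ∷ []) = begin
  (binomPred x j + 0) + pred x C suc (j + 0)  ≡⟨ cong₂ (λ s t → s + pred x C suc t) (+-identityʳ (binomPred x j)) (+-identityʳ j) ⟩
  binomPred x j + pred x C suc j              ≡⟨ binomPred-pascal x j ⟩
  x C suc j                                   ≤⟨ m≤m+n (x C suc j) 0 ⟩
  x C suc j + 0                               ∎
  where open ≤-Reasoning
kmSumFrom-shadow {suc l} j (x ∷ y ∷ ys) = begin
  (binomPred x j + K) + P                     ≡⟨ +-assoc (binomPred x j) K P ⟩
  binomPred x j + (K + P)                     ≤⟨ +-mono-≤ head≤ tail≤ ⟩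
  x C suc j + binSumFrom (suc j) (y ∷ ys)     ∎
  where
  open ≤-Reasoning
  K = kmSumFrom (suc j) (y ∷ ys)
  P = pred (last (y ∷ ys)) C suc (j + suc l)
  head≤ : binomPred x j ≤ x C suc j
  head≤ = subst (binomPred x j ≤_) (binomPred-pascal x j) (m≤m+n _ _)
  tail≤ : K + P ≤ binSumFrom (suc j) (y ∷ ys)
  tail≤ = subst (λ t → K + pred (last (y ∷ ys)) C suc t ≤ binSumFrom (suc j) (y ∷ ys))
                (sym (+-suc j l)) (kmSumFrom-shadow (suc j) (y ∷ ys))

kmSumFrom-shift : ∀ {l} j (xs : Vec ℕ l) → kmSumFrom (suc j) xs ≡ binSumFrom j (map pred xs)
kmSumFrom-shift j []           = refl
kmSumFrom-shift j (zero ∷ xs)  = cong₂ _+_ (sym (k>n⇒nCk≡0 {0} {suc j} (s≤s z≤n))) (kmSumFrom-shift (suc j) xs)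
kmSumFrom-shift j (suc x ∷ xs) = cong (x C suc j +_) (kmSumFrom-shift (suc j) xs)

binomPred-zero≤1 : ∀ x → binomPred x 0 ≤ 1
binomPred-zero≤1 zero    = z≤n
binomPred-zero≤1 (suc x) = ≤-refl

∂-upper : ∀ m (v : Vec ℕ (suc (suc m))) → Increasing v → ∂ v ≤ last v C suc m
∂-upper m (x ∷ w) inc = begin
  binomPred x 0 + kmSumFrom 1 w   ≡⟨ cong (binomPred x 0 +_) (kmSumFrom-shift 0 w) ⟩
  binomPred x 0 + binSum w′       ≤⟨ +-monoˡ-≤ (binSum w′) (binomPred-zero≤1 x) ⟩
  head w′ C 0 + binSum w′         ≤⟨ binSumFrom-upper 0 w′ (increasing-pred x w inc) ⟩
  suc (last w′) C suc m           ≡⟨ cong (λ t → suc t C suc m) (last-map pred w) ⟩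
  suc (pred N) C suc m            ≡⟨ cong (_C suc m) (suc-pred N {{last-nonZero x w inc}}) ⟩
  N C suc m                       ∎
  where
  open ≤-Reasoning
  w′ = map pred w
  N  = last w

lemma6 : (m : ℕ) (n a : ℕ)
    (nv : Vec ℕ (suc (suc m))) (av : Vec ℕ (suc m)) (bv : Vec ℕ (suc (suc m))) →
    IsBinRep (suc (suc m)) n nv →
    a < ∂ nv →
    IsBinRep (suc m) a av →
    IsBinRep (suc (suc m)) (n ∸ a) bv →
    (last av < last nv) × (last nv ≤ last bv + 1)
lemma6 m n a nv@(x ∷ w) av bv (nv-inc , n≡) a<∂n (_ , a≡) (bv-inc , b≡) = aₖ<N , N≤bₖ₊₁+1
  where
  open ≤-Reasoning
  N    = last nv
  inc  = strictlyIncreasing⇒increasing nv nv-inc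
  -- C(N - 1 , k + 1) is the top remainder in the shadow estimate for n.
  P    = pred N C suc (suc m)

  aₖ<N : last av < N
  aₖ<N = C-cancelˡ-< (suc m) (begin-strict
    last av C suc m  ≤⟨ binSumFrom-lower 0 av ⟩
    binSum av        ≡⟨ a≡ ⟩
    a                <⟨ a<∂n ⟩
    ∂ nv             ≤⟨ ∂-upper m nv inc ⟩
    N C suc m        ∎)

  P<n∸a : P < n ∸ a
  P<n∸a = m+n≤o⇒m≤o∸n (suc P) (begin
    suc P + a        ≡⟨ +-comm (suc P) a ⟩
    a + suc P        ≡⟨ +-suc a P ⟩
    suc a + P        ≤⟨ +-monoˡ-≤ P a<∂n ⟩
    ∂ nv + P         ≤⟨ kmSumFrom-shadow 0 nv ⟩
    binSum nv        ≡⟨ n≡ ⟩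
    n                ∎)

  n∸a<top : n ∸ a < suc (last bv) C suc (suc m)
  n∸a<top = subst (_< suc (last bv) C suc (suc m)) b≡
                  (binSumFrom-upper 0 bv (strictlyIncreasing⇒increasing bv bv-inc))

  N≤bₖ₊₁+1 : N ≤ last bv + 1
  N≤bₖ₊₁+1 = begin
    N                ≡⟨ suc-pred N {{last-nonZero x w inc}} ⟨
    suc (pred N)     ≤⟨ C-cancelˡ-< (suc (suc m)) (<-trans P<n∸a n∸a<top) ⟩
    suc (last bv)    ≡⟨ +-comm 1 (last bv) ⟩
    last bv + 1      ∎
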